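{- Let $n\ge 3$. If $k\in\{2,\ldots,n-1\}$, then ${\rm sjc}_k(P_n)=n-\left\lfloor \frac{n}{k+1}\right\rfloor$. If $\ell\in\{2,\ldots,n-2\}$, then ${\rm sjc}_{\ell}(C_n)=n-1-\left\lfloor \frac{n-1}{\ell+1}\right\rfloor$. Moreover, ${\rm sjc}_{n-1}(C_n)=n$.
   Context: $P_n$ and $C_n$ denote the path and the cycle on $n$ vertices. For a graph $G$ and nonempty $W\subseteq V(G)$, the Steiner distance $d_G(W)$ is the minimum number of edges of a connected subgraph of $G$ containing $W$ ($\infty$ if none exists). For an integer $k\ge 2$, a set $A\subseteq V(G)$ with $|A|\ge k$ is a $k$-Steiner join-critical set if $d_{G[A]}(B)\neq k$ for every $B\subseteq A$ with $|B|=k$, where $G[A]$ is the subgraph induced by $A$; ${\rm sjc}_k(G)$ is the largest cardinality of a $k$-Steiner join-critical set of $G$. -}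

module Defs where

open import Data.Nat using (ℕ; zero; suc; _<_; _≤_)
open import Data.Fin using (Fin; toℕ)
open import Data.Fin.Subset using (Subset; _∈_; _⊆_; ∣_∣)
open import Data.List using (List; length)
open import Data.List.Relation.Unary.Unique.Propositional using (Unique)
import Data.List.Membership.Propositional as LM
open import Data.Product using (_×_; _,_; Σ; ∃)
open import Data.Sum using (_⊎_)
open import Relation.Binary.PropositionalEquality using (_≡_)
open import Relation.Nullary using (¬_)

Graph : ℕ → Set₁
Graph n = Fin n → Fin n → Set

PathG : (n : ℕ) → Graph n
PathG n i j = suc (toℕ i) ≡ toℕ j ⊎ suc (toℕ j) ≡ toℕ i

CycleG : (n : ℕ) → Graph n
CycleG n i j = PathG n i j
             ⊎ (toℕ i ≡ 0 × suc (toℕ j) ≡ n)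
             ⊎ (toℕ j ≡ 0 × suc (toℕ i) ≡ n)

-- Edge sets are lists of pairs (i , j) with toℕ i < toℕ j (each unordered
-- pair has a unique representation); reachability along such an edge list.
data Reach {n : ℕ} (E : List (Fin n × Fin n)) : Fin n → Fin n → Set where
  here : ∀ {u} → Reach E u u
  fwd  : ∀ {u w v} → (u , w) LM.∈ E → Reach E w v → Reach E u v
  bwd  : ∀ {u w v} → (w , u) LM.∈ E → Reach E w v → Reach E u v

record SteinerSubgraph {n : ℕ} (G : Graph n) (A B : Subset n) (m : ℕ) : Set where
  field
    S        : Subset n
    E        : List (Fin n × Fin n)
    S⊆A      : S ⊆ A
    B⊆S      : B ⊆ S
    edgesOK  : ∀ {i j} → (i , j) LM.∈ E → (toℕ i < toℕ j) × G i j × i ∈ S × j ∈ S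
    distinct : Unique E
    size     : length E ≡ m
    conn     : ∀ {u v} → u ∈ S → v ∈ S → Reach E u v

SteinerDistIs : {n : ℕ} → Graph n → Subset n → Subset n → ℕ → Set
SteinerDistIs G A B m = SteinerSubgraph G A B m × (∀ m′ → m′ < m → ¬ SteinerSubgraph G A B m′)

SJC : {n : ℕ} → Graph n → ℕ → Subset n → Set
SJC G k A = k ≤ ∣ A ∣ × (∀ B → B ⊆ A → ∣ B ∣ ≡ k → ¬ SteinerDistIs G A B k)

SjcIs : {n : ℕ} → Graph n → ℕ → ℕ → Set
SjcIs G k s = (Σ _ λ A → SJC G k A × ∣ A ∣ ≡ s) × (∀ A → SJC G k A → ∣ A ∣ ≤ s)

-- Lower bounds: deleting every (k + 1)-th vertex of a path leaves components with at most k
-- vertices, so no connected subgraph of what remains has k edges; on C_n the last vertex is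
-- deleted as well, which leaves a subset of the path on n - 1 vertices.
-- Upper bounds: a larger set A contains k + 1 consecutive vertices a, …, a + k. If every edge of
-- G[A] joins consecutive positions, a connected subgraph containing a and a + k must cross each
-- of the k cuts in between, so B = {a, …, a + k - 2, a + k} has Steiner distance exactly k in
-- G[A]. On C_n a vertex outside A is rotated to the last position to make this so; if A is all
-- of C_n, a connected subgraph containing B either uses all n - 1 edges of a path or misses an
-- edge of the cycle, and cutting the cycle there gives the same bound. Finally, for k = n - 1
-- every B of size n - 1 misses a vertex w, and the path C_n - w joins B with n - 2 edges.

module Submission where

open import Defs
open import Data.Bool using (Bool; true; false; _∧_; _∨_; not; if_then_else_)
open import Data.Empty using (⊥-elim)
open import Data.Fin as Fin using (Fin; toℕ; fromℕ<)
open import Data.Fin.Properties using (toℕ-fromℕ<; toℕ-injective; toℕ<n; pigeonhole; all?; ¬∀⟶∃¬)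
open import Data.Fin.Subset using (Subset; _∈_; _⊆_; ∣_∣; ⊤)
open import Data.Fin.Subset.Properties using (_∈?_; ∈⊤; ∣⊤∣≡n; ∣p∣≤n; p⊆q⇒∣p∣≤∣q∣)
open import Data.List as List using (List; []; _∷_; length; lookup)
open import Data.List.Membership.Propositional using () renaming (_∈_ to _∈ₗ_)
open import Data.List.Membership.Propositional.Properties using (∈-lookup; ∈-map⁻; ∈-map⁺; ∈-upTo⁻; ∈-upTo⁺)
open import Data.List.Properties using (length-map; length-upTo)
open import Data.List.Relation.Unary.All as All using ()
open import Data.List.Relation.Unary.All.Properties using (map⁺)
open import Data.List.Relation.Unary.AllPairs using ([]; _∷_)
open import Data.List.Relation.Unary.Any as Any using (here; there)
open import Data.List.Relation.Unary.Any.Properties using (lookup-index)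
open import Data.List.Relation.Unary.Unique.Propositional using (Unique)
open import Data.List.Relation.Unary.Unique.Propositional.Properties using (upTo⁺)
open import Data.Nat
open import Data.Nat.DivMod
open import Data.Nat.Properties
open import Data.Product using (_×_; _,_; Σ; proj₁; proj₂)
open import Data.Product.Properties using (≡-dec)
open import Data.Sum as Sum using (_⊎_; inj₁; inj₂)
open import Data.Vec.Base using (Vec; []; _∷_; tabulate; here; there)
open import Function using (_∘_)
open import Relation.Binary.Definitions using (Tri; tri<; tri≈; tri>)
open import Relation.Binary.PropositionalEquality
open import Relation.Nullary using (¬_; Dec; yes; no; does)
open import Relation.Nullary.Decidable using (dec-true; dec-false; ¬?; decidable-stable)

module _ {p} {P : Set p} where

  does-true : (P? : Dec P) → does P? ≡ true → P
  does-true (yes x) _ = x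

  does-false : (P? : Dec P) → does P? ≡ false → ¬ P
  does-false (no ¬x) _ = ¬x

∧-true : ∀ {b c} → b ∧ c ≡ true → b ≡ true × c ≡ true
∧-true {true} {true} _ = refl , refl

bit : Bool → ℕ
bit true = 1
bit false = 0

count : (ℕ → Bool) → ℕ → ℕ
count f zero = 0
count f (suc N) = bit (f 0) + count (λ p → f (suc p)) N

count-cong : ∀ {f g} N → (∀ p → p < N → f p ≡ g p) → count f N ≡ count g N
count-cong zero eq = refl
count-cong (suc N) eq =
  cong₂ _+_ (cong bit (eq 0 z<s)) (count-cong N (λ p p<N → eq (suc p) (s<s p<N)))

count-+ : ∀ f M N → count f (M + N) ≡ count f M + count (λ p → f (M + p)) N
count-+ f zero N = refl
count-+ f (suc M) N =
  trans (cong (bit (f 0) +_) (count-+ (λ p → f (suc p)) M N)) (sym (+-assoc (bit (f 0)) _ _))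

count-suc : ∀ f N → count f (suc N) ≡ count f N + bit (f N)
count-suc f N = begin
  count f (suc N)                              ≡⟨ cong (count f) (+-comm 1 N) ⟩
  count f (N + 1)                              ≡⟨ count-+ f N 1 ⟩
  count f N + (bit (f (N + 0)) + 0)            ≡⟨ cong (λ m → count f N + (bit (f m) + 0)) (+-identityʳ N) ⟩
  count f N + (bit (f N) + 0)                  ≡⟨ cong (count f N +_) (+-identityʳ _) ⟩
  count f N + bit (f N)                        ∎
  where open ≡-Reasoning

count≤n : ∀ f N → count f N ≤ N
count≤n f zero = z≤n
count≤n f (suc N) = +-mono-≤ (bit≤1 (f 0)) (count≤n (λ p → f (suc p)) N)
  where
  bit≤1 : ∀ b → bit b ≤ 1
  bit≤1 true = s≤s z≤n
  bit≤1 false = z≤n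

count≡n⇒all : ∀ f N → count f N ≡ N → ∀ p → p < N → f p ≡ true
count≡n⇒all f (suc N) eq p p<N with f 0 in f0
count≡n⇒all f (suc N) eq zero p<N | true = f0
count≡n⇒all f (suc N) eq (suc p) (s≤s p<N) | true =
  count≡n⇒all (λ p → f (suc p)) N (suc-injective eq) p p<N
count≡n⇒all f (suc N) eq p p<N | false = ⊥-elim (<-irrefl eq (s≤s (count≤n (λ p → f (suc p)) N)))

all⇒count≡n : ∀ f N → (∀ p → p < N → f p ≡ true) → count f N ≡ N
all⇒count≡n f zero all = refl
all⇒count≡n f (suc N) all rewrite all 0 z<s =
  cong suc (all⇒count≡n (λ p → f (suc p)) N (λ p p<N → all (suc p) (s<s p<N)))

none⇒count≡0 : ∀ f N → (∀ p → p < N → f p ≡ false) → count f N ≡ 0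
none⇒count≡0 f zero none = refl
none⇒count≡0 f (suc N) none rewrite none 0 z<s =
  none⇒count≡0 (λ p → f (suc p)) N (λ p p<N → none (suc p) (s<s p<N))

m≡[m/n]*n+m%n : ∀ m n .{{_ : NonZero n}} → m ≡ m / n * n + m % n
m≡[m/n]*n+m%n m n = trans (m≡m%n+[m/n]*n m n) (+-comm (m % n) _)

∸/suc≡blocks : ∀ k N → N ∸ N / suc k ≡ N / suc k * k + N % suc k
∸/suc≡blocks k N = begin
  N ∸ q                        ≡⟨ cong (_∸ q) N≡ ⟩
  q + (q * k + N % suc k) ∸ q  ≡⟨ m+n∸m≡n q _ ⟩
  q * k + N % suc k            ∎
  where
  open ≡-Reasoning
  q : ℕ
  q = N / suc k
  N≡ : N ≡ q + (q * k + N % suc k)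
  N≡ = begin
    N                          ≡⟨ m≡[m/n]*n+m%n N (suc k) ⟩
    q * suc k + N % suc k      ≡⟨ cong (_+ N % suc k) (*-suc q k) ⟩
    q + q * k + N % suc k      ≡⟨ +-assoc q _ _ ⟩
    q + (q * k + N % suc k)    ∎

Run : (ℕ → Bool) → ℕ → ℕ → Set
Run f k N = Σ ℕ λ a → a + k < N × (∀ i → i ≤ k → f (a + i) ≡ true)

Run-shift : ∀ f k M N → Run (λ p → f (M + p)) k N → Run f k (M + N)
Run-shift f k M N (a , a+k<N , run) =
  M + a , subst (_< M + N) (sym (+-assoc M a k)) (+-monoʳ-< M a+k<N) ,
  λ i i≤k → trans (cong f (+-assoc M a i)) (run i i≤k)

count≤blocks⊎Run : ∀ k f q r → count f (q * suc k + r) ≤ q * k + r ⊎ Run f k (q * suc k + r)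
count≤blocks⊎Run k f zero r = inj₁ (count≤n f r)
count≤blocks⊎Run k f (suc q) r with count f (suc k) ≟ suc k
... | yes full = inj₂ (0 , s≤s (≤-trans (m≤m+n k _) (m≤m+n _ r)) ,
                       λ i i≤k → count≡n⇒all f (suc k) full i (s≤s i≤k))
... | no ¬full = Sum.map bound shift (count≤blocks⊎Run k g q r)
  where
  g : ℕ → Bool
  g p = f (suc k + p)
  M : ℕ
  M = q * suc k + r
  assoc : suc k + q * suc k + r ≡ suc k + M
  assoc = +-assoc (suc k) (q * suc k) r
  bound : count g M ≤ q * k + r → count f (suc q * suc k + r) ≤ suc q * k + r
  bound hyp = begin
    count f (suc k + q * suc k + r)  ≡⟨ cong (count f) assoc ⟩
    count f (suc k + M)              ≡⟨ count-+ f (suc k) M ⟩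
    count f (suc k) + count g M      ≤⟨ +-mono-≤ (≤-pred (≤∧≢⇒< (count≤n f (suc k)) ¬full)) hyp ⟩
    k + (q * k + r)                  ≡⟨ +-assoc k (q * k) r ⟨
    k + q * k + r                    ∎
    where open ≤-Reasoning
  shift : Run g k M → Run f k (suc q * suc k + r)
  shift run = subst (Run f k) (sym assoc) (Run-shift f k (suc k) M run)

count≤⊎Run : ∀ k f N → count f N ≤ N ∸ N / suc k ⊎ Run f k N
count≤⊎Run k f N with count≤blocks⊎Run k f (N / suc k) (N % suc k)
... | inj₁ bound = inj₁ (subst₂ _≤_ (cong (count f) (sym (m≡[m/n]*n+m%n N (suc k)))) (sym (∸/suc≡blocks k N)) bound)
... | inj₂ run = inj₂ (subst (Run f k) (sym (m≡[m/n]*n+m%n N (suc k))) run)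

notBlockEnd : ℕ → ℕ → Bool
notBlockEnd k p = not (does (p % suc k ≟ k))

notBlockEnd-periodic : ∀ k p → notBlockEnd k (suc k + p) ≡ notBlockEnd k p
notBlockEnd-periodic k p =
  cong (λ m → not (does (m ≟ k))) (trans (cong (_% suc k) (+-comm (suc k) p)) ([m+n]%n≡m%n p (suc k)))

notBlockEnd-< : ∀ k p → p < k → notBlockEnd k p ≡ true
notBlockEnd-< k p p<k =
  cong not (dec-false (p % suc k ≟ k) λ eq → <-irrefl (trans (sym (m<n⇒m%n≡m (m<n⇒m<1+n p<k))) eq) p<k)

notBlockEnd-k : ∀ k → notBlockEnd k k ≡ false
notBlockEnd-k k = cong not (dec-true (k % suc k ≟ k) (m<n⇒m%n≡m (n<1+n k)))

notBlockEnd⇒%≢ : ∀ k p → notBlockEnd k p ≡ true → p % suc k ≢ k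
notBlockEnd⇒%≢ k p keep eq with trans (sym keep) (cong not (dec-true (p % suc k ≟ k) eq))
... | ()

count-notBlockEnd-blocks : ∀ k q r → r ≤ k → count (notBlockEnd k) (q * suc k + r) ≡ q * k + r
count-notBlockEnd-blocks k zero r r≤k =
  all⇒count≡n (notBlockEnd k) r (λ p p<r → notBlockEnd-< k p (<-≤-trans p<r r≤k))
count-notBlockEnd-blocks k (suc q) r r≤k = begin
  count f (suc k + q * suc k + r)               ≡⟨ cong (count f) (+-assoc (suc k) (q * suc k) r) ⟩
  count f (suc k + M)                           ≡⟨ count-+ f (suc k) M ⟩
  count f (suc k) + count (λ p → f (suc k + p)) M
     ≡⟨ cong₂ _+_ oneBlock (count-cong M (λ p _ → notBlockEnd-periodic k p)) ⟩
  k + count f M                                 ≡⟨ cong (k +_) (count-notBlockEnd-blocks k q r r≤k) ⟩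
  k + (q * k + r)                               ≡⟨ +-assoc k (q * k) r ⟨
  k + q * k + r                                 ∎
  where
  open ≡-Reasoning
  f : ℕ → Bool
  f = notBlockEnd k
  M : ℕ
  M = q * suc k + r
  oneBlock : count f (suc k) ≡ k
  oneBlock = begin
    count f (suc k)        ≡⟨ count-suc f k ⟩
    count f k + bit (f k)  ≡⟨ cong₂ _+_ (all⇒count≡n f k (notBlockEnd-< k)) (cong bit (notBlockEnd-k k)) ⟩
    k + 0                  ≡⟨ +-identityʳ k ⟩
    k                      ∎

count-notBlockEnd : ∀ k N → count (notBlockEnd k) N ≡ N ∸ N / suc k
count-notBlockEnd k N = begin
  count (notBlockEnd k) N                             ≡⟨ cong (count _) (m≡[m/n]*n+m%n N (suc k)) ⟩
  count (notBlockEnd k) (N / suc k * suc k + N % suc k)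
     ≡⟨ count-notBlockEnd-blocks k (N / suc k) (N % suc k) (≤-pred (m%n<n N (suc k))) ⟩
  N / suc k * k + N % suc k                           ≡⟨ ∸/suc≡blocks k N ⟨
  N ∸ N / suc k                                       ∎
  where open ≡-Reasoning

notBlockEndBelow : ℕ → ℕ → ℕ → Bool
notBlockEndBelow N k p = does (p <? N) ∧ notBlockEnd k p

count-notBlockEndBelow : ∀ N k n → N ≤ n → count (notBlockEndBelow N k) n ≡ N ∸ N / suc k
count-notBlockEndBelow N k n N≤n = begin
  count f n                                          ≡⟨ cong (count f) (m+[n∸m]≡n N≤n) ⟨
  count f (N + (n ∸ N))                              ≡⟨ count-+ f N (n ∸ N) ⟩
  count f N + count (λ p → f (N + p)) (n ∸ N)         ≡⟨ cong₂ _+_ below above ⟩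
  count (notBlockEnd k) N + 0                        ≡⟨ +-identityʳ _ ⟩
  count (notBlockEnd k) N                            ≡⟨ count-notBlockEnd k N ⟩
  N ∸ N / suc k                                      ∎
  where
  open ≡-Reasoning
  f : ℕ → Bool
  f = notBlockEndBelow N k
  below : count f N ≡ count (notBlockEnd k) N
  below = count-cong N (λ p p<N → cong (_∧ notBlockEnd k p) (dec-true (p <? N) p<N))
  above : count (λ p → f (N + p)) (n ∸ N) ≡ 0
  above = none⇒count≡0 _ (n ∸ N)
    (λ p _ → cong (_∧ notBlockEnd k (N + p)) (dec-false (N + p <? N) (m+n≮m N p)))

suc-sameBlock : ∀ k i → i % suc (suc k) ≢ suc k →
                suc i % suc (suc k) ≡ suc (i % suc (suc k)) × suc i / suc (suc k) ≡ i / suc (suc k)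
suc-sameBlock k i i%≢ = %≡ , /≡
  where
  d : ℕ
  d = suc (suc k)
  i%<k : i % d < suc k
  i%<k = ≤∧≢⇒< (≤-pred (m%n<n i d)) i%≢
  1%d : 1 % d ≡ 1
  1%d = m<n⇒m%n≡m {d} {1} (s≤s (s≤s z≤n))
  %≡ : suc i % d ≡ suc (i % d)
  %≡ = begin
    (1 + i) % d                ≡⟨ cong (_% d) (+-comm 1 i) ⟩
    (i + 1) % d                ≡⟨ %-distribˡ-+ i 1 d ⟩
    (i % d + 1 % d) % d        ≡⟨ cong (λ m → (i % d + m) % d) 1%d ⟩
    (i % d + 1) % d            ≡⟨ cong (_% d) (+-comm (i % d) 1) ⟩
    suc (i % d) % d            ≡⟨ m<n⇒m%n≡m (s≤s i%<k) ⟩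
    suc (i % d)                ∎
    where open ≡-Reasoning
  /≡ : suc i / d ≡ i / d
  /≡ = begin
    (1 + i) / d                ≡⟨ cong (_/ d) (+-comm 1 i) ⟩
    (i + 1) / d                ≡⟨ +-distrib-/ i 1 (subst (λ m → i % d + m < d) (sym 1%d) (subst (_< d) (+-comm 1 (i % d)) (s≤s i%<k))) ⟩
    i / d + 1 / d              ≡⟨ cong (i / d +_) (m<n⇒m/n≡0 {1} {d} (s≤s (s≤s z≤n))) ⟩
    i / d + 0                  ≡⟨ +-identityʳ _ ⟩
    i / d                      ∎
    where open ≡-Reasoning

k≤∸/suc : ∀ k N → suc k ≤ N → k ≤ N ∸ N / suc k
k≤∸/suc k N k<N = begin
  k                              ≡⟨ *-identityˡ k ⟨
  1 * k                          ≤⟨ *-monoˡ-≤ k (m≥n⇒m/n>0 k<N) ⟩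
  N / suc k * k                  ≤⟨ m≤m+n _ (N % suc k) ⟩
  N / suc k * k + N % suc k      ≡⟨ ∸/suc≡blocks k N ⟨
  N ∸ N / suc k                  ∎
  where open ≤-Reasoning

-- rotate s r is the rotation x ↦ x + r modulo s + r.
rotate : ℕ → ℕ → ℕ → ℕ
rotate s r x = if does (x <? s) then x + r else x ∸ s

rotate-< : ∀ s r x → x < s → rotate s r x ≡ x + r
rotate-< s r x x<s rewrite dec-true (x <? s) x<s = refl

rotate-+ : ∀ s r x → rotate s r (s + x) ≡ x
rotate-+ s r x rewrite dec-false (s + x <? s) (m+n≮m s x) = m+n∸m≡n s x

data Split (s x : ℕ) : Set where
  below : x < s → Split s x
  above : ∀ y → x ≡ s + y → Split s x

split : ∀ s x → Split s x
split s x with x <? s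
... | yes x<s = below x<s
... | no x≮s = above (x ∸ s) (sym (m+[n∸m]≡n (≮⇒≥ x≮s)))

rotate-bounded : ∀ s r x → x < s + r → rotate s r x < s + r
rotate-bounded s r x x<s+r with split s x
... | below x<s rewrite rotate-< s r x x<s = +-monoˡ-< r x<s
... | above y refl rewrite rotate-+ s r y = ≤-trans (+-cancelˡ-< s y r x<s+r) (m≤n+m r s)

rotate-inverse : ∀ s r x → x < s + r → rotate r s (rotate s r x) ≡ x
rotate-inverse s r x x<s+r with split s x
... | below x<s rewrite rotate-< s r x x<s = trans (cong (rotate r s) (+-comm x r)) (rotate-+ r s x)
... | above y refl rewrite rotate-+ s r y = trans (rotate-< r s y (+-cancelˡ-< s y r x<s+r)) (+-comm y s)

count-rotate : ∀ f s r → count (λ p → f (rotate s r p)) (s + r) ≡ count f (r + s)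
count-rotate f s r = begin
  count (λ p → f (rotate s r p)) (s + r)
    ≡⟨ count-+ _ s r ⟩
  count (λ p → f (rotate s r p)) s + count (λ p → f (rotate s r (s + p))) r
    ≡⟨ cong₂ _+_ (count-cong s (λ p p<s → cong f (trans (rotate-< s r p p<s) (+-comm p r))))
                 (count-cong r (λ p _ → cong f (rotate-+ s r p))) ⟩
  count (λ p → f (r + p)) s + count f r
    ≡⟨ +-comm _ (count f r) ⟩
  count f r + count (λ p → f (r + p)) s
    ≡⟨ count-+ f r s ⟨
  count f (r + s) ∎
  where open ≡-Reasoning

CycleAdj : ℕ → ℕ → ℕ → Set
CycleAdj N x y = suc x ≡ y ⊎ suc y ≡ x ⊎ (x ≡ 0 × suc y ≡ N) ⊎ (y ≡ 0 × suc x ≡ N)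

CycleAdj-sym : ∀ {N x y} → CycleAdj N x y → CycleAdj N y x
CycleAdj-sym (inj₁ e) = inj₂ (inj₁ e)
CycleAdj-sym (inj₂ (inj₁ e)) = inj₁ e
CycleAdj-sym (inj₂ (inj₂ (inj₁ e))) = inj₂ (inj₂ (inj₂ e))
CycleAdj-sym (inj₂ (inj₂ (inj₂ e))) = inj₂ (inj₂ (inj₁ e))

rotate-adj-suc : ∀ s r x → suc x < s + r → CycleAdj (s + r) (rotate s r x) (rotate s r (suc x))
rotate-adj-suc s r x sx<s+r with split s x
... | above y refl = inj₁ (begin
  suc (rotate s r (s + y))  ≡⟨ cong suc (rotate-+ s r y) ⟩
  suc y                     ≡⟨ rotate-+ s r (suc y) ⟨
  rotate s r (s + suc y)    ≡⟨ cong (rotate s r) (+-suc s y) ⟩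
  rotate s r (suc (s + y))  ∎)
  where open ≡-Reasoning
... | below x<s with m≤n⇒m<n∨m≡n x<s
...   | inj₁ sx<s = inj₁ (trans (cong suc (rotate-< s r x x<s)) (sym (rotate-< s r (suc x) sx<s)))
...   | inj₂ sx≡s = inj₂ (inj₂ (inj₂ (wrap , trans (cong suc (rotate-< s r x x<s)) (cong (_+ r) sx≡s))))
  where
  wrap : rotate s r (suc x) ≡ 0
  wrap = trans (cong (rotate s r) (trans sx≡s (sym (+-identityʳ s)))) (rotate-+ s r 0)

rotate-adj-wrap : ∀ s r y → suc y ≡ s + r → CycleAdj (s + r) (rotate s r 0) (rotate s r y)
rotate-adj-wrap zero r y sy≡ = inj₂ (inj₂ (inj₁ (refl , sy≡)))
rotate-adj-wrap (suc s) zero y sy≡ =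
  inj₂ (inj₂ (inj₁ (rotate-< (suc s) 0 0 z<s ,
    trans (cong suc (trans (rotate-< (suc s) 0 y y<) (+-identityʳ y))) sy≡)))
  where
  y< : y < suc s
  y< = subst (y <_) (+-identityʳ (suc s)) (subst (suc y ≤_) sy≡ ≤-refl)
rotate-adj-wrap (suc s) (suc r) y sy≡ =
  inj₂ (inj₁ (trans (cong suc (trans (cong (rotate (suc s) (suc r)) y≡) (rotate-+ (suc s) (suc r) r)))
                    (sym (rotate-< (suc s) (suc r) 0 z<s))))
  where
  y≡ : y ≡ suc s + r
  y≡ = suc-injective (trans sy≡ (cong suc (+-suc s r)))

rotate-adj : ∀ s r x y → x < s + r → y < s + r →
             CycleAdj (s + r) x y → CycleAdj (s + r) (rotate s r x) (rotate s r y)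
rotate-adj s r x y x< y< (inj₁ refl) = rotate-adj-suc s r x y<
rotate-adj s r x y x< y< (inj₂ (inj₁ refl)) = CycleAdj-sym (rotate-adj-suc s r y x<)
rotate-adj s r x y x< y< (inj₂ (inj₂ (inj₁ (refl , e)))) = rotate-adj-wrap s r y e
rotate-adj s r x y x< y< (inj₂ (inj₂ (inj₂ (refl , e)))) = CycleAdj-sym (rotate-adj-wrap s r x e)

lookupℕ : ∀ {n} → Vec Bool n → ℕ → Bool
lookupℕ [] p = false
lookupℕ (b ∷ v) zero = b
lookupℕ (b ∷ v) (suc p) = lookupℕ v p

∣A∣≡count : ∀ {n} (A : Subset n) → ∣ A ∣ ≡ count (lookupℕ A) n
∣A∣≡count [] = refl
∣A∣≡count (true ∷ A) = cong suc (∣A∣≡count A)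
∣A∣≡count (false ∷ A) = ∣A∣≡count A

∈⇒lookupℕ : ∀ {n} {A : Subset n} {x : Fin n} → x ∈ A → lookupℕ A (toℕ x) ≡ true
∈⇒lookupℕ here = refl
∈⇒lookupℕ (there x∈A) = ∈⇒lookupℕ x∈A

lookupℕ⇒∈ : ∀ {n} (A : Subset n) (x : Fin n) → lookupℕ A (toℕ x) ≡ true → x ∈ A
lookupℕ⇒∈ (true ∷ A) Fin.zero _ = here
lookupℕ⇒∈ (b ∷ A) (Fin.suc x) eq = there (lookupℕ⇒∈ A x eq)

∉⇒lookupℕ : ∀ {n} (A : Subset n) x → ¬ x ∈ A → lookupℕ A (toℕ x) ≡ false
∉⇒lookupℕ A x x∉A with lookupℕ A (toℕ x) in eq
... | true = ⊥-elim (x∉A (lookupℕ⇒∈ A x eq))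
... | false = refl

fromPred : ∀ {n} → (ℕ → Bool) → Subset n
fromPred f = tabulate (λ x → f (toℕ x))

lookupℕ-fromPred : ∀ {n} f p → p < n → lookupℕ (fromPred {n} f) p ≡ f p
lookupℕ-fromPred {suc n} f zero _ = refl
lookupℕ-fromPred {suc n} f (suc p) (s≤s p<n) = lookupℕ-fromPred {n} (λ q → f (suc q)) p p<n

∈fromPred⇒ : ∀ {n} f (x : Fin n) → x ∈ fromPred f → f (toℕ x) ≡ true
∈fromPred⇒ f x x∈ = trans (sym (lookupℕ-fromPred f (toℕ x) (toℕ<n x))) (∈⇒lookupℕ x∈)

⇒∈fromPred : ∀ {n} f (x : Fin n) → f (toℕ x) ≡ true → x ∈ fromPred f
⇒∈fromPred f x fx = lookupℕ⇒∈ (fromPred f) x (trans (lookupℕ-fromPred f (toℕ x) (toℕ<n x)) fx)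

∣fromPred∣≡count : ∀ {n} f → ∣ fromPred {n} f ∣ ≡ count f n
∣fromPred∣≡count {n} f = trans (∣A∣≡count (fromPred {n} f)) (count-cong n (lookupℕ-fromPred {n} f))

-- toFin p is junk (zero) when p > n.
toFin : ∀ n → ℕ → Fin (suc n)
toFin n p with p <? suc n
... | yes p<1+n = fromℕ< p<1+n
... | no _ = Fin.zero

toℕ-toFin : ∀ n p → p < suc n → toℕ (toFin n p) ≡ p
toℕ-toFin n p p<1+n with p <? suc n
... | yes p<1+n = toℕ-fromℕ< p<1+n
... | no p≮1+n = ⊥-elim (p≮1+n p<1+n)

toFin-toℕ : ∀ n (x : Fin (suc n)) → toFin n (toℕ x) ≡ x
toFin-toℕ n x = toℕ-injective (toℕ-toFin n (toℕ x) (toℕ<n x))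

module _ {n : ℕ} {E : List (Fin n × Fin n)} where

  Reach-trans : ∀ {u w v} → Reach E u w → Reach E w v → Reach E u v
  Reach-trans here r = r
  Reach-trans (fwd e r) r′ = fwd e (Reach-trans r r′)
  Reach-trans (bwd e r) r′ = bwd e (Reach-trans r r′)

  Reach-sym : ∀ {u v} → Reach E u v → Reach E v u
  Reach-sym here = here
  Reach-sym (fwd e r) = Reach-trans (Reach-sym r) (bwd e here)
  Reach-sym (bwd e r) = Reach-trans (Reach-sym r) (fwd e here)

  Crosses : (Fin n → Bool) → Fin n × Fin n → Set
  Crosses P (i , j) = (P i ≡ true × P j ≡ false) ⊎ (P i ≡ false × P j ≡ true)

  Reach⇒crossingEdge : ∀ P {u v} → Reach E u v → P u ≡ true → P v ≡ false →
                       Σ (Fin n × Fin n) λ e → e ∈ₗ E × Crosses P e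
  Reach⇒crossingEdge P here Pu Pv with trans (sym Pu) Pv
  ... | ()
  Reach⇒crossingEdge P (fwd {w = w} e r) Pu Pv with P w in Pw
  ... | true = Reach⇒crossingEdge P r Pw Pv
  ... | false = _ , e , inj₁ (Pu , Pw)
  Reach⇒crossingEdge P (bwd {w = w} e r) Pu Pv with P w in Pw
  ... | true = Reach⇒crossingEdge P r Pw Pv
  ... | false = _ , e , inj₂ (Pw , Pu)

Unique⇒lookup-injective : ∀ {A : Set} {xs : List A} → Unique xs →
                          ∀ p q → p Fin.< q → lookup xs p ≢ lookup xs q
Unique⇒lookup-injective {xs = x ∷ xs} (x∉ ∷ u) Fin.zero (Fin.suc q) _ eq = All.lookup x∉ (∈-lookup q) eq
Unique⇒lookup-injective {xs = x ∷ xs} (x∉ ∷ u) (Fin.suc p) (Fin.suc q) (s≤s p<q) eq =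
  Unique⇒lookup-injective u p q p<q eq

hits⇒≤length : ∀ {X : Set} (g : X → ℕ) (E : List X) a c →
               (∀ t → t < c → Σ X λ e → e ∈ₗ E × g e ≡ a + t) → c ≤ length E
hits⇒≤length {X} g E a c hit with c ≤? length E
... | yes c≤ = c≤
... | no c≰ with pigeonhole (≰⇒> c≰) index
  where
  index : Fin c → Fin (length E)
  index t = Any.index (proj₁ (proj₂ (hit (toℕ t) (toℕ<n t))))
... | i , j , i<j , same = ⊥-elim (<-irrefl (+-cancelˡ-≡ a _ _ gi≡gj) i<j)
  where
  edge : (t : Fin c) → Σ X λ e → e ∈ₗ E × g e ≡ a + toℕ t
  edge t = hit (toℕ t) (toℕ<n t)
  gi≡gj : a + toℕ i ≡ a + toℕ j
  gi≡gj = trans (sym (proj₂ (proj₂ (edge i))))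
          (trans (cong g (trans (lookup-index (proj₁ (proj₂ (edge i))))
                         (trans (cong (lookup E) same) (sym (lookup-index (proj₁ (proj₂ (edge j))))))))
                 (proj₂ (proj₂ (edge j))))

injectiveInto⇒length≤ : ∀ {X : Set} (g : X → ℕ) (E : List X) a c → Unique E →
                        (∀ {x y} → x ∈ₗ E → y ∈ₗ E → g x ≡ g y → x ≡ y) →
                        (∀ {x} → x ∈ₗ E → a ≤ g x × g x < a + c) → length E ≤ c
injectiveInto⇒length≤ g E a c unique inj range with length E ≤? c
... | yes ≤c = ≤c
... | no ≰c with pigeonhole (≰⇒> ≰c) offset
  where
  offset : Fin (length E) → Fin c
  offset p = fromℕ< {g (lookup E p) ∸ a}
    (+-cancelˡ-< a _ _ (subst (_< a + c) (sym (m+[n∸m]≡n (proj₁ (range (∈-lookup p))))) (proj₂ (range (∈-lookup p)))))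
... | p , q , p<q , same = ⊥-elim (Unique⇒lookup-injective unique p q p<q (inj (∈-lookup p) (∈-lookup q) gp≡gq))
  where
  gp≡gq : g (lookup E p) ≡ g (lookup E q)
  gp≡gq = trans (sym (m+[n∸m]≡n (proj₁ (range (∈-lookup p)))))
          (trans (cong (a +_) (trans (sym (toℕ-fromℕ< _)) (trans (cong toℕ same) (toℕ-fromℕ< _))))
                 (m+[n∸m]≡n (proj₁ (range (∈-lookup q)))))

UnitStep : ∀ {n} → (Fin n → ℕ) → Fin n → Fin n → Set
UnitStep pos i j = suc (pos i) ≡ pos j ⊎ suc (pos j) ≡ pos i

module Layout {n : ℕ} (E : List (Fin n × Fin n)) (pos : Fin n → ℕ)
              (unitSteps : ∀ {i j} → (i , j) ∈ₗ E → UnitStep pos i j) where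

  lowerEnd : Fin n × Fin n → ℕ
  lowerEnd (i , j) = pos i ⊓ pos j

  -- Every cut {x | pos x ≤ t} separating u from v is crossed by an edge starting at t.
  Reach⇒edgeAt : ∀ {u v} → Reach E u v → ∀ t → pos u ≤ t → t < pos v →
                 Σ (Fin n × Fin n) λ e → e ∈ₗ E × lowerEnd e ≡ t
  Reach⇒edgeAt r t u≤t t<v
    with Reach⇒crossingEdge (λ x → does (pos x ≤? t)) r (dec-true (_ ≤? t) u≤t) (dec-false (_ ≤? t) (<⇒≱ t<v))
  ... | (i , j) , e∈E , crosses with unitSteps e∈E | crosses
  ... | inj₁ up | inj₁ (i≤t , j≰t) =
    _ , e∈E , trans (m≤n⇒m⊓n≡m (subst (pos i ≤_) up (n≤1+n _)))
                    (≤-antisym (does-true (_ ≤? t) i≤t) (≤-pred (subst (t <_) (sym up) (≰⇒> (does-false (_ ≤? t) j≰t)))))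
  ... | inj₁ up | inj₂ (i≰t , j≤t) =
    ⊥-elim (does-false (_ ≤? t) i≰t (≤-trans (≤-trans (n≤1+n _) (≤-reflexive up)) (does-true (_ ≤? t) j≤t)))
  ... | inj₂ down | inj₂ (i≰t , j≤t) =
    _ , e∈E , trans (m≥n⇒m⊓n≡n (subst (pos j ≤_) down (n≤1+n _)))
                    (≤-antisym (does-true (_ ≤? t) j≤t) (≤-pred (subst (t <_) (sym down) (≰⇒> (does-false (_ ≤? t) i≰t)))))
  ... | inj₂ down | inj₁ (i≤t , j≰t) =
    ⊥-elim (does-false (_ ≤? t) j≰t (≤-trans (≤-trans (n≤1+n _) (≤-reflexive down)) (does-true (_ ≤? t) i≤t)))

  Reach⇒span≤length : ∀ {u v} → Reach E u v → pos u ≤ pos v → pos v ∸ pos u ≤ length E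
  Reach⇒span≤length {u} {v} r u≤v = hits⇒≤length lowerEnd E (pos u) (pos v ∸ pos u)
    (λ t t< → Reach⇒edgeAt r (pos u + t) (m≤m+n _ t)
                (subst (pos u + t <_) (m+[n∸m]≡n u≤v) (+-monoʳ-< (pos u) t<)))

span≤size : ∀ {n} {G : Graph n} {A B m} (H : SteinerSubgraph G A B m) (pos : Fin n → ℕ) →
            (∀ {i j} → (i , j) ∈ₗ SteinerSubgraph.E H → UnitStep pos i j) →
            ∀ {u v} → u ∈ B → v ∈ B → pos u ≤ pos v → pos v ∸ pos u ≤ m
span≤size H pos unitSteps u∈B v∈B u≤v =
  subst (_ ≤_) size (Layout.Reach⇒span≤length E pos unitSteps (conn (B⊆S u∈B) (B⊆S v∈B)) u≤v)
  where open SteinerSubgraph H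

unitSteps-in : ∀ {n} {G : Graph n} {A B m} (H : SteinerSubgraph G A B m) (pos : Fin n → ℕ) →
               (∀ {i j} → G i j → i ∈ A → j ∈ A → UnitStep pos i j) →
               ∀ {i j} → (i , j) ∈ₗ SteinerSubgraph.E H → UnitStep pos i j
unitSteps-in H pos unitSteps e∈E with SteinerSubgraph.edgesOK H e∈E
... | _ , g , i∈S , j∈S = unitSteps g (SteinerSubgraph.S⊆A H i∈S) (SteinerSubgraph.S⊆A H j∈S)

record Relabelling (n : ℕ) : Set where
  field
    pos unpos   : ℕ → ℕ
    pos<        : ∀ x → x < suc n → pos x < suc n
    unpos<      : ∀ p → p < suc n → unpos p < suc n
    pos-unpos   : ∀ p → p < suc n → pos (unpos p) ≡ p
    unpos-pos   : ∀ x → x < suc n → unpos (pos x) ≡ x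
    count-pos   : ∀ f → count (λ x → f (pos x)) (suc n) ≡ count f (suc n)
    count-unpos : ∀ f → count (λ p → f (unpos p)) (suc n) ≡ count f (suc n)

  posᶠ : Fin (suc n) → ℕ
  posᶠ x = pos (toℕ x)

  vertexAt : ℕ → Fin (suc n)
  vertexAt p = toFin n (unpos p)

  posᶠ-vertexAt : ∀ p → p < suc n → posᶠ (vertexAt p) ≡ p
  posᶠ-vertexAt p p< = trans (cong pos (toℕ-toFin n (unpos p) (unpos< p p<))) (pos-unpos p p<)

  vertexAt-posᶠ : ∀ x → vertexAt (posᶠ x) ≡ x
  vertexAt-posᶠ x = trans (cong (toFin n) (unpos-pos (toℕ x) (toℕ<n x))) (toFin-toℕ n x)

  posᶠ< : ∀ x → posᶠ x < suc n
  posᶠ< x = pos< (toℕ x) (toℕ<n x)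

  posᶠ-injective : ∀ x y → posᶠ x ≡ posᶠ y → x ≡ y
  posᶠ-injective x y eq = trans (sym (vertexAt-posᶠ x)) (trans (cong vertexAt eq) (vertexAt-posᶠ y))

Unique-map : ∀ {X Y : Set} (f : X → Y) {xs : List X} →
             (∀ {x y} → x ∈ₗ xs → y ∈ₗ xs → f x ≡ f y → x ≡ y) → Unique xs → Unique (List.map f xs)
Unique-map f {[]} inj [] = []
Unique-map f {x ∷ xs} inj (x∉ ∷ u) =
  map⁺ (All.tabulate (λ {y} y∈ eq → All.lookup x∉ y∈ (inj (here refl) (there y∈) eq)))
  ∷ Unique-map f (λ x∈ y∈ eq → inj (there x∈) (there y∈) eq) u

orient : ∀ {n} → Fin n → Fin n → Fin n × Fin n
orient x y with toℕ x <? toℕ y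
... | yes _ = x , y
... | no _ = y , x

orient-cases : ∀ {n} (x y : Fin n) →
               (orient x y ≡ (x , y) × toℕ x < toℕ y) ⊎ (orient x y ≡ (y , x) × ¬ toℕ x < toℕ y)
orient-cases x y with toℕ x <? toℕ y
... | yes x<y = inj₁ (refl , x<y)
... | no x≮y = inj₂ (refl , x≮y)

Reach-orient : ∀ {n} {E : List (Fin n × Fin n)} x y → orient x y ∈ₗ E → Reach E x y
Reach-orient x y e∈E with orient-cases x y
... | inj₁ (eq , _) = fwd (subst (_∈ₗ _) eq e∈E) here
... | inj₂ (eq , _) = bwd (subst (_∈ₗ _) eq e∈E) here

orient-⊓ : ∀ {n} (pos : Fin n → ℕ) x y → pos (proj₁ (orient x y)) ⊓ pos (proj₂ (orient x y)) ≡ pos x ⊓ pos y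
orient-⊓ pos x y with orient-cases x y
... | inj₁ (eq , _) rewrite eq = refl
... | inj₂ (eq , _) rewrite eq = ⊓-comm (pos y) (pos x)

module PositionPath {n : ℕ} (G : Graph (suc n)) (G-sym : ∀ {x y} → G x y → G y x)
  (G-irrefl : ∀ {x y} → G x y → toℕ x ≢ toℕ y) (R : Relabelling n) (a L : ℕ) (a+L< : a + L < suc n)
  (adjacent : ∀ p → p < L → G (Relabelling.vertexAt R (a + p)) (Relabelling.vertexAt R (a + suc p))) where
  open Relabelling R

  inRange : ℕ → Bool
  inRange x = does (a ≤? pos x) ∧ does (pos x ≤? a + L)

  S : Subset (suc n)
  S = fromPred inRange

  edge : ℕ → Fin (suc n) × Fin (suc n)
  edge p = orient (vertexAt (a + p)) (vertexAt (a + suc p))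

  E : List (Fin (suc n) × Fin (suc n))
  E = List.map edge (List.upTo L)

  inRange⇒ : ∀ x → inRange (toℕ x) ≡ true → a ≤ posᶠ x × posᶠ x ≤ a + L
  inRange⇒ x inR = does-true (a ≤? _) (proj₁ (∧-true inR)) , does-true (_ ≤? a + L) (proj₂ (∧-true inR))

  ⇒∈S : ∀ x → a ≤ posᶠ x → posᶠ x ≤ a + L → x ∈ S
  ⇒∈S x a≤ ≤a+L = ⇒∈fromPred inRange x (cong₂ _∧_ (dec-true (a ≤? _) a≤) (dec-true (_ ≤? a + L) ≤a+L))

  vertexAt∈S : ∀ p → p ≤ L → vertexAt (a + p) ∈ S
  vertexAt∈S p p≤L = ⇒∈S _ (subst (a ≤_) (sym pos≡) (m≤m+n a p)) (subst (_≤ a + L) (sym pos≡) (+-monoʳ-≤ a p≤L))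
    where
    pos≡ : posᶠ (vertexAt (a + p)) ≡ a + p
    pos≡ = posᶠ-vertexAt (a + p) (≤-<-trans (+-monoʳ-≤ a p≤L) a+L<)

  lowerEnd-edge : ∀ p → p < L → posᶠ (proj₁ (edge p)) ⊓ posᶠ (proj₂ (edge p)) ≡ a + p
  lowerEnd-edge p p<L = begin
    posᶠ (proj₁ (edge p)) ⊓ posᶠ (proj₂ (edge p))         ≡⟨ orient-⊓ posᶠ _ _ ⟩
    posᶠ (vertexAt (a + p)) ⊓ posᶠ (vertexAt (a + suc p))
      ≡⟨ cong₂ _⊓_ (posᶠ-vertexAt _ (<-trans (+-monoʳ-< a p<L) a+L<)) (posᶠ-vertexAt _ (≤-<-trans (+-monoʳ-≤ a p<L) a+L<)) ⟩
    (a + p) ⊓ (a + suc p)                                 ≡⟨ m≤n⇒m⊓n≡m (+-monoʳ-≤ a (n≤1+n p)) ⟩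
    a + p                                                 ∎
    where open ≡-Reasoning

  edge-ok : ∀ p → p < L → let (i , j) = edge p in toℕ i < toℕ j × G i j × i ∈ S × j ∈ S
  edge-ok p p<L with orient-cases (vertexAt (a + p)) (vertexAt (a + suc p))
  ... | inj₁ (eq , i<j) rewrite eq = i<j , adjacent p p<L , vertexAt∈S p (<⇒≤ p<L) , vertexAt∈S (suc p) p<L
  ... | inj₂ (eq , i≮j) rewrite eq =
    ≤∧≢⇒< (≮⇒≥ i≮j) (λ eq → G-irrefl (adjacent p p<L) (sym eq)) , G-sym (adjacent p p<L) ,
    vertexAt∈S (suc p) p<L , vertexAt∈S p (<⇒≤ p<L)

  Reach-first : ∀ p → p ≤ L → Reach E (vertexAt (a + 0)) (vertexAt (a + p))
  Reach-first zero _ = here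
  Reach-first (suc p) p<L = Reach-trans (Reach-first p (<⇒≤ p<L)) (Reach-orient _ _ (∈-map⁺ edge (∈-upTo⁺ p<L)))

  Reach-S : ∀ x → x ∈ S → Reach E (vertexAt (a + 0)) x
  Reach-S x x∈S = subst (Reach E _) (trans (cong vertexAt (m+[n∸m]≡n a≤)) (vertexAt-posᶠ x))
                    (Reach-first (posᶠ x ∸ a) (m≤n+o⇒m∸n≤o (posᶠ x) a ≤a+L))
    where
    a≤ : a ≤ posᶠ x
    a≤ = proj₁ (inRange⇒ x (∈fromPred⇒ inRange x x∈S))
    ≤a+L : posᶠ x ≤ a + L
    ≤a+L = proj₂ (inRange⇒ x (∈fromPred⇒ inRange x x∈S))

  edge-injective : ∀ {p q} → p ∈ₗ List.upTo L → q ∈ₗ List.upTo L → edge p ≡ edge q → p ≡ q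
  edge-injective {p} {q} p∈ q∈ eq = +-cancelˡ-≡ a _ _
    (trans (sym (lowerEnd-edge p (∈-upTo⁻ p∈)))
      (trans (cong (λ e → posᶠ (proj₁ e) ⊓ posᶠ (proj₂ e)) eq) (lowerEnd-edge q (∈-upTo⁻ q∈))))

  pathSubgraph : (A B : Subset (suc n)) → S ⊆ A → B ⊆ S → SteinerSubgraph G A B L
  pathSubgraph A B S⊆A B⊆S = record
    { S = S ; E = E ; S⊆A = S⊆A ; B⊆S = B⊆S
    ; edgesOK = edgesOK
    ; distinct = Unique-map edge edge-injective (upTo⁺ L)
    ; size = trans (length-map edge (List.upTo L)) (length-upTo L)
    ; conn = λ u∈ v∈ → Reach-trans (Reach-sym (Reach-S _ u∈)) (Reach-S _ v∈) }
    where
    edgesOK : ∀ {i j} → (i , j) ∈ₗ E → toℕ i < toℕ j × G i j × i ∈ S × j ∈ S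
    edgesOK e∈E with ∈-map⁻ edge e∈E
    ... | p , p∈ , refl = edge-ok p (∈-upTo⁻ p∈)

module Witness {n : ℕ} (R : Relabelling n) (a k₂ : ℕ) (a+k< : a + suc (suc k₂) < suc n) where
  open Relabelling R

  k : ℕ
  k = suc (suc k₂)

  gapped : ℕ → Bool
  gapped p = does (p ≤? k₂) ∨ does (p ≟ k)

  gapped-≤ : ∀ p → p ≤ k₂ → gapped p ≡ true
  gapped-≤ p p≤ rewrite dec-true (p ≤? k₂) p≤ = refl

  gapped-k : gapped k ≡ true
  gapped-k rewrite dec-false (k ≤? k₂) (λ k≤ → 1+n≰n (≤-trans (n≤1+n (suc k₂)) k≤)) = dec-true (k ≟ k) refl

  gapped-> : ∀ p → k < p → gapped p ≡ false
  gapped-> p k<p rewrite dec-false (p ≤? k₂) (λ p≤ → <-asym k<p (≤-<-trans p≤ (≤-trans (n<1+n k₂) (n≤1+n _))))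
                       | dec-false (p ≟ k) (λ eq → <-irrefl (sym eq) k<p) = refl

  gapped⇒≤k : ∀ p → gapped p ≡ true → p ≤ k
  gapped⇒≤k p g with p ≤? k
  ... | yes p≤k = p≤k
  ... | no p≰k with trans (sym g) (gapped-> p (≰⇒> p≰k))
  ...   | ()

  count-gapped : count gapped (suc k) ≡ k
  count-gapped = begin
    count gapped (suc k)                                         ≡⟨ count-suc gapped k ⟩
    count gapped (suc (suc k₂)) + bit (gapped k)                 ≡⟨ cong₂ _+_ (count-suc gapped (suc k₂)) (cong bit gapped-k) ⟩
    count gapped (suc k₂) + bit (gapped (suc k₂)) + 1
      ≡⟨ cong (λ m → m + bit (gapped (suc k₂)) + 1) (all⇒count≡n gapped (suc k₂) (λ p p< → gapped-≤ p (≤-pred p<))) ⟩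
    suc k₂ + bit (gapped (suc k₂)) + 1                           ≡⟨ cong (λ b → suc k₂ + bit b + 1) gap ⟩
    suc k₂ + 0 + 1                                               ≡⟨ cong (_+ 1) (+-identityʳ (suc k₂)) ⟩
    suc k₂ + 1                                                   ≡⟨ +-comm (suc k₂) 1 ⟩
    k                                                            ∎
    where
    open ≡-Reasoning
    gap : gapped (suc k₂) ≡ false
    gap rewrite dec-false (suc k₂ ≤? k₂) (<-irrefl refl) | dec-false (suc k₂ ≟ k) (λ eq → <-irrefl eq (n<1+n _)) = refl

  inB : ℕ → Bool
  inB q = does (a ≤? q) ∧ gapped (q ∸ a)

  B : Subset (suc n)
  B = fromPred (λ x → inB (pos x))

  inB-< : ∀ q → q < a → inB q ≡ false
  inB-< q q<a rewrite dec-false (a ≤? q) (<⇒≱ q<a) = refl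

  inB-+ : ∀ p → inB (a + p) ≡ gapped p
  inB-+ p rewrite dec-true (a ≤? a + p) (m≤m+n a p) = cong gapped (m+n∸m≡n a p)

  count-inB : count inB (suc n) ≡ k
  count-inB = begin
    count inB (suc n)                                      ≡⟨ cong (count inB) n≡ ⟩
    count inB (a + (suc k + r))                            ≡⟨ count-+ inB a _ ⟩
    count inB a + count (λ p → inB (a + p)) (suc k + r)
      ≡⟨ cong₂ _+_ (none⇒count≡0 inB a inB-<) (count-cong (suc k + r) (λ p _ → inB-+ p)) ⟩
    count gapped (suc k + r)                               ≡⟨ count-+ gapped (suc k) r ⟩
    count gapped (suc k) + count (λ p → gapped (suc k + p)) r
      ≡⟨ cong₂ _+_ count-gapped (none⇒count≡0 _ r (λ p _ → gapped-> (suc k + p) (m≤m+n (suc k) p))) ⟩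
    k + 0                                                  ≡⟨ +-identityʳ k ⟩
    k                                                      ∎
    where
    open ≡-Reasoning
    r : ℕ
    r = suc n ∸ (a + suc k)
    n≡ : suc n ≡ a + (suc k + r)
    n≡ = trans (sym (m+[n∸m]≡n (subst (_≤ suc n) (sym (+-suc a k)) a+k<))) (+-assoc a (suc k) r)

  ∣B∣≡k : ∣ B ∣ ≡ k
  ∣B∣≡k = trans (∣fromPred∣≡count {suc n} (λ x → inB (pos x))) (trans (count-pos inB) count-inB)

  B-bounds : ∀ x → x ∈ B → a ≤ posᶠ x × posᶠ x ≤ a + k
  B-bounds x x∈B = a≤ , subst (_≤ a + k) (m+[n∸m]≡n a≤) (+-monoʳ-≤ a (gapped⇒≤k _ (proj₂ inB≡)))
    where
    inB≡ : does (a ≤? posᶠ x) ≡ true × gapped (posᶠ x ∸ a) ≡ true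
    inB≡ = ∧-true (∈fromPred⇒ (λ x → inB (pos x)) x x∈B)
    a≤ : a ≤ posᶠ x
    a≤ = does-true (a ≤? _) (proj₁ inB≡)

  ∈B : ∀ q → q < suc n → inB q ≡ true → vertexAt q ∈ B
  ∈B q q< inBq = ⇒∈fromPred (λ x → inB (pos x)) (vertexAt q) (trans (cong inB (posᶠ-vertexAt q q<)) inBq)

  first∈B : vertexAt (a + 0) ∈ B
  first∈B = ∈B (a + 0) (≤-<-trans (+-monoʳ-≤ a z≤n) a+k<) (trans (inB-+ 0) (gapped-≤ 0 z≤n))

  last∈B : vertexAt (a + k) ∈ B
  last∈B = ∈B (a + k) a+k< (trans (inB-+ k) gapped-k)

module Run⇒¬SJC {n : ℕ} (G : Graph (suc n)) (G-sym : ∀ {x y} → G x y → G y x)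
  (G-irrefl : ∀ {x y} → G x y → toℕ x ≢ toℕ y) (R : Relabelling n) (A : Subset (suc n))
  (a k₂ : ℕ) (a+k< : a + suc (suc k₂) < suc n)
  (run : ∀ i → i ≤ suc (suc k₂) → Relabelling.vertexAt R (a + i) ∈ A)
  (adjacent : ∀ p → p < suc (suc k₂) → G (Relabelling.vertexAt R (a + p)) (Relabelling.vertexAt R (a + suc p))) where
  open Relabelling R
  open Witness R a k₂ a+k< public
  open PositionPath G G-sym G-irrefl R a k a+k< adjacent using (S; inRange; inRange⇒; ⇒∈S; pathSubgraph)

  S⊆A : S ⊆ A
  S⊆A {x} x∈S = subst (_∈ A) x≡ (run (posᶠ x ∸ a) (m≤n+o⇒m∸n≤o (posᶠ x) a ≤a+k))
    where
    a≤ : a ≤ posᶠ x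
    a≤ = proj₁ (inRange⇒ x (∈fromPred⇒ inRange x x∈S))
    ≤a+k : posᶠ x ≤ a + k
    ≤a+k = proj₂ (inRange⇒ x (∈fromPred⇒ inRange x x∈S))
    x≡ : vertexAt (a + (posᶠ x ∸ a)) ≡ x
    x≡ = trans (cong vertexAt (m+[n∸m]≡n a≤)) (vertexAt-posᶠ x)

  B⊆S : B ⊆ S
  B⊆S {x} x∈B = ⇒∈S x (proj₁ (B-bounds x x∈B)) (proj₂ (B-bounds x x∈B))

  steinerB : SteinerSubgraph G A B k
  steinerB = pathSubgraph A B S⊆A B⊆S

  module _ (unitSteps : ∀ {i j} → G i j → i ∈ A → j ∈ A → UnitStep posᶠ i j) where

    noShorter : ∀ m → m < k → ¬ SteinerSubgraph G A B m
    noShorter m m<k H = <⇒≱ m<k (subst (_≤ m) span≡k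
      (span≤size H posᶠ (unitSteps-in H posᶠ unitSteps) first∈B last∈B (subst₂ _≤_ (sym pos-first) (sym pos-last) (+-monoʳ-≤ a z≤n))))
      where
      pos-first : posᶠ (vertexAt (a + 0)) ≡ a + 0
      pos-first = posᶠ-vertexAt (a + 0) (≤-<-trans (+-monoʳ-≤ a z≤n) a+k<)
      pos-last : posᶠ (vertexAt (a + k)) ≡ a + k
      pos-last = posᶠ-vertexAt (a + k) a+k<
      span≡k : posᶠ (vertexAt (a + k)) ∸ posᶠ (vertexAt (a + 0)) ≡ k
      span≡k = trans (cong₂ _∸_ pos-last (trans pos-first (+-identityʳ a))) (m+n∸m≡n a k)

    ¬SJC : ¬ SJC G k A
    ¬SJC (_ , critical) = critical B (λ x∈B → S⊆A (B⊆S x∈B)) ∣B∣≡k (steinerB , noShorter)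

module Extremal {n : ℕ} (G : Graph (suc n)) (N k₂ : ℕ) (N≤ : N ≤ suc n) where

  k d : ℕ
  k = suc (suc k₂)
  d = suc k

  A⋆ : Subset (suc n)
  A⋆ = fromPred (notBlockEndBelow N k)

  ∣A⋆∣ : ∣ A⋆ ∣ ≡ N ∸ N / d
  ∣A⋆∣ = trans (∣fromPred∣≡count {suc n} (notBlockEndBelow N k)) (count-notBlockEndBelow N k (suc n) N≤)

  ∈A⋆⇒ : ∀ x → x ∈ A⋆ → toℕ x % d ≢ k
  ∈A⋆⇒ x x∈ = notBlockEnd⇒%≢ k (toℕ x) (proj₂ (∧-true (∈fromPred⇒ (notBlockEndBelow N k) x x∈)))

  module _ (forward : ∀ {i j} → G i j → i ∈ A⋆ → j ∈ A⋆ → toℕ i < toℕ j → suc (toℕ i) ≡ toℕ j) where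

    -- The components of G[A⋆] lie in single blocks, so edges are determined by the residue of their tail.
    size<k : ∀ {B m} → SteinerSubgraph G A⋆ B m → m ≤ suc k₂
    size<k {B} {m} H = subst (_≤ suc k₂) size
      (injectiveInto⇒length≤ residue E 0 (suc k₂) distinct residue-injective residue-range)
      where
      open SteinerSubgraph H
      step : ∀ {i j} → (i , j) ∈ₗ E → suc (toℕ i) ≡ toℕ j × toℕ i % d ≢ k × toℕ j % d ≢ k
      step e∈E with edgesOK e∈E
      ... | i<j , g , i∈S , j∈S = forward g (S⊆A i∈S) (S⊆A j∈S) i<j , ∈A⋆⇒ _ (S⊆A i∈S) , ∈A⋆⇒ _ (S⊆A j∈S)
      block : ∀ {u v} → Reach E u v → toℕ u / d ≡ toℕ v / d
      block here = refl
      block (fwd {u} e∈E r) with step e∈E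
      ... | i→j , i%≢ , _ = trans (sym (trans (cong (_/ d) (sym i→j)) (proj₂ (suc-sameBlock (suc k₂) (toℕ u) i%≢)))) (block r)
      block (bwd {u} {w} e∈E r) with step e∈E
      ... | i→j , i%≢ , _ = trans (trans (cong (_/ d) (sym i→j)) (proj₂ (suc-sameBlock (suc k₂) (toℕ w) i%≢))) (block r)
      residue : Fin (suc n) × Fin (suc n) → ℕ
      residue (i , j) = toℕ i % d
      residue-range : ∀ {e} → e ∈ₗ E → 0 ≤ residue e × residue e < 0 + suc k₂
      residue-range {i , j} e∈E with step e∈E
      ... | i→j , i%≢ , j%≢ = z≤n , ≤-pred (≤∧≢⇒< (≤∧≢⇒< (≤-pred (m%n<n (toℕ i) d)) i%≢) (λ eq → j%≢ (trans (sym (cong (_% d) i→j)) (trans j% eq))))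
        where
        j% : suc (toℕ i) % d ≡ suc (toℕ i % d)
        j% = proj₁ (suc-sameBlock (suc k₂) (toℕ i) i%≢)
      residue-injective : ∀ {e e′} → e ∈ₗ E → e′ ∈ₗ E → residue e ≡ residue e′ → e ≡ e′
      residue-injective {i , j} {i′ , j′} e∈E e′∈E eq with edgesOK e∈E | edgesOK e′∈E
      ... | _ , _ , i∈S , _ | _ , _ , i′∈S , _ =
        cong₂ _,_ (toℕ-injective i≡) (toℕ-injective (trans (sym (proj₁ (step e∈E))) (trans (cong suc i≡) (proj₁ (step e′∈E)))))
        where
        i≡ : toℕ i ≡ toℕ i′
        i≡ = trans (m≡m%n+[m/n]*n (toℕ i) d)
             (trans (cong₂ (λ r q → r + q * d) eq (block (conn i∈S i′∈S))) (sym (m≡m%n+[m/n]*n (toℕ i′) d)))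

    SJC-A⋆ : suc k ≤ N → SJC G k A⋆
    SJC-A⋆ k<N = subst (k ≤_) (sym ∣A⋆∣) (k≤∸/suc k N k<N) ,
                 λ B _ _ dist → 1+n≰n (size<k (proj₁ dist))

identityRelabelling : ∀ n → Relabelling n
identityRelabelling n = record
  { pos = λ x → x ; unpos = λ p → p ; pos< = λ _ x< → x< ; unpos< = λ _ p< → p<
  ; pos-unpos = λ _ _ → refl ; unpos-pos = λ _ _ → refl ; count-pos = λ _ → refl ; count-unpos = λ _ → refl }

rotation : ∀ n s r → suc n ≡ s + r → Relabelling n
rotation n s r n≡ = record
  { pos = rotate s r ; unpos = rotate r s
  ; pos< = λ x x< → subst (rotate s r x <_) (sym n≡) (rotate-bounded s r x (subst (x <_) n≡ x<))
  ; unpos< = λ p p< → subst (rotate r s p <_) (sym n≡′) (rotate-bounded r s p (subst (p <_) n≡′ p<))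
  ; pos-unpos = λ p p< → rotate-inverse r s p (subst (p <_) n≡′ p<)
  ; unpos-pos = λ x x< → rotate-inverse s r x (subst (x <_) n≡ x<)
  ; count-pos = λ f → trans (subst (λ m → count (λ x → f (rotate s r x)) m ≡ count f (r + s)) (sym n≡) (count-rotate f s r))
                            (cong (count f) (sym n≡′))
  ; count-unpos = λ f → trans (subst (λ m → count (λ p → f (rotate r s p)) m ≡ count f (s + r)) (sym n≡′) (count-rotate f r s))
                              (cong (count f) (sym n≡))
  }
  where
  n≡′ : suc n ≡ r + s
  n≡′ = trans n≡ (+-comm s r)

PathG-sym : ∀ {n} {x y : Fin n} → PathG n x y → PathG n y x
PathG-sym (inj₁ e) = inj₂ e
PathG-sym (inj₂ e) = inj₁ e

PathG-irrefl : ∀ {n} {x y : Fin n} → PathG n x y → toℕ x ≢ toℕ y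
PathG-irrefl (inj₁ e) eq = 1+n≢n (trans e (sym eq))
PathG-irrefl (inj₂ e) eq = 1+n≢n (trans e eq)

PathG-toFin : ∀ n p → suc p < suc n → PathG (suc n) (toFin n p) (toFin n (suc p))
PathG-toFin n p sp< = inj₁ (trans (cong suc (toℕ-toFin n p (<-trans (n<1+n p) sp<))) (sym (toℕ-toFin n (suc p) sp<)))

CycleG⇒CycleAdj : ∀ {n} {x y : Fin n} → CycleG n x y → CycleAdj n (toℕ x) (toℕ y)
CycleG⇒CycleAdj (inj₁ (inj₁ e)) = inj₁ e
CycleG⇒CycleAdj (inj₁ (inj₂ e)) = inj₂ (inj₁ e)
CycleG⇒CycleAdj (inj₂ (inj₁ e)) = inj₂ (inj₂ (inj₁ e))
CycleG⇒CycleAdj (inj₂ (inj₂ e)) = inj₂ (inj₂ (inj₂ e))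

CycleAdj⇒CycleG : ∀ {n} {x y : Fin n} → CycleAdj n (toℕ x) (toℕ y) → CycleG n x y
CycleAdj⇒CycleG (inj₁ e) = inj₁ (inj₁ e)
CycleAdj⇒CycleG (inj₂ (inj₁ e)) = inj₁ (inj₂ e)
CycleAdj⇒CycleG (inj₂ (inj₂ (inj₁ e))) = inj₂ (inj₁ e)
CycleAdj⇒CycleG (inj₂ (inj₂ (inj₂ e))) = inj₂ (inj₂ e)

CycleG-sym : ∀ {n} {x y : Fin n} → CycleG n x y → CycleG n y x
CycleG-sym c = CycleAdj⇒CycleG (CycleAdj-sym (CycleG⇒CycleAdj c))

CycleG-irrefl : ∀ {n} {x y : Fin (3 + n)} → CycleG (3 + n) x y → toℕ x ≢ toℕ y
CycleG-irrefl (inj₁ p) eq = PathG-irrefl p eq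
CycleG-irrefl (inj₂ (inj₁ (x≡0 , sy≡))) eq with trans (sym sy≡) (cong suc (trans (sym eq) x≡0))
... | ()
CycleG-irrefl (inj₂ (inj₂ (y≡0 , sx≡))) eq with trans (sym sx≡) (cong suc (trans eq y≡0))
... | ()

CycleAdj⇒UnitStep : ∀ {n x y} → CycleAdj (suc n) x y → x ≢ n → y ≢ n → suc x ≡ y ⊎ suc y ≡ x
CycleAdj⇒UnitStep (inj₁ e) _ _ = inj₁ e
CycleAdj⇒UnitStep (inj₂ (inj₁ e)) _ _ = inj₂ e
CycleAdj⇒UnitStep (inj₂ (inj₂ (inj₁ (_ , e)))) _ y≢n = ⊥-elim (y≢n (suc-injective e))
CycleAdj⇒UnitStep (inj₂ (inj₂ (inj₂ (_ , e)))) x≢n _ = ⊥-elim (x≢n (suc-injective e))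

-- The rotation of C_{n+1} moving vertex v to the last position n.
module LastAt {n : ℕ} (v : ℕ) (v≤n : v ≤ n) where

  r : ℕ
  r = n ∸ v

  n≡ : suc n ≡ suc v + r
  n≡ = cong suc (sym (m+[n∸m]≡n v≤n))

  R : Relabelling n
  R = rotation n (suc v) r n≡

  open Relabelling R public

  posᶠ-≤ : ∀ x → x ≤ v → posᶠ (toFin n x) ≡ x + r
  posᶠ-≤ x x≤v = trans (cong (rotate (suc v) r) (toℕ-toFin n x (s≤s (≤-trans x≤v v≤n)))) (rotate-< (suc v) r x (s≤s x≤v))

  posᶠ-> : ∀ p → suc v + p < suc n → posᶠ (toFin n (suc v + p)) ≡ p
  posᶠ-> p x< = trans (cong (rotate (suc v) r) (toℕ-toFin n _ x<)) (rotate-+ (suc v) r p)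

  posᶠ-v : posᶠ (toFin n v) ≡ n
  posᶠ-v = trans (posᶠ-≤ v ≤-refl) (m+[n∸m]≡n v≤n)

  posᶠ≡n⇒ : ∀ x → posᶠ x ≡ n → x ≡ toFin n v
  posᶠ≡n⇒ x eq = posᶠ-injective x _ (trans eq (sym posᶠ-v))

  posᶠ-suc-v : v < n → posᶠ (toFin n (suc v)) ≡ 0
  posᶠ-suc-v v<n = subst (λ x → posᶠ (toFin n x) ≡ 0) (+-identityʳ (suc v))
    (posᶠ-> 0 (subst (_< suc n) (sym (+-identityʳ (suc v))) (s≤s v<n)))

  adjacent : ∀ p → suc p < suc n → CycleG (suc n) (vertexAt p) (vertexAt (suc p))
  adjacent p sp< = CycleAdj⇒CycleG
    (subst₂ (CycleAdj (suc n)) (sym (toℕ-toFin n _ (unpos< p (<-trans (n<1+n p) sp<)))) (sym (toℕ-toFin n _ (unpos< (suc p) sp<)))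
      (subst (λ m → CycleAdj m (rotate r (suc v) p) (rotate r (suc v) (suc p))) (sym n≡′)
        (rotate-adj-suc r (suc v) p (subst (suc p <_) n≡′ sp<))))
    where
    n≡′ : suc n ≡ r + suc v
    n≡′ = trans n≡ (+-comm (suc v) r)

  CycleG⇒CycleAdj-pos : ∀ {i j} → CycleG (suc n) i j → CycleAdj (suc n) (posᶠ i) (posᶠ j)
  CycleG⇒CycleAdj-pos {i} {j} c = subst (λ m → CycleAdj m (posᶠ i) (posᶠ j)) (sym n≡)
    (rotate-adj (suc v) r (toℕ i) (toℕ j) (subst (toℕ i <_) n≡ (toℕ<n i)) (subst (toℕ j <_) n≡ (toℕ<n j))
      (subst (λ m → CycleAdj m (toℕ i) (toℕ j)) n≡ (CycleG⇒CycleAdj c)))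

SJC⇒∣A∣≤ : ∀ {n} (G : Graph (suc n)) → (∀ {x y} → G x y → G y x) → (∀ {x y} → G x y → toℕ x ≢ toℕ y) →
           (R : Relabelling n) (A : Subset (suc n)) (N k₂ : ℕ) → N ≤ suc n →
           ∣ A ∣ ≡ count (λ p → lookupℕ A (Relabelling.unpos R p)) N →
           (∀ p → suc p < N → G (Relabelling.vertexAt R p) (Relabelling.vertexAt R (suc p))) →
           (∀ {i j} → G i j → i ∈ A → j ∈ A → UnitStep (Relabelling.posᶠ R) i j) →
           SJC G (suc (suc k₂)) A → ∣ A ∣ ≤ N ∸ N / suc (suc (suc k₂))
SJC⇒∣A∣≤ {n} G G-sym G-irrefl R A N k₂ N≤ ∣A∣≡ adjacent unitSteps sjc
  with count≤⊎Run (suc (suc k₂)) (λ p → lookupℕ A (Relabelling.unpos R p)) N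
... | inj₁ bound = subst (_≤ _) (sym ∣A∣≡) bound
... | inj₂ (a , a+k<N , run) =
  ⊥-elim (Run⇒¬SJC.¬SJC G G-sym G-irrefl R A a k₂ a+k< vertexRun adjacentRun unitSteps sjc)
  where
  open Relabelling R
  k : ℕ
  k = suc (suc k₂)
  a+k< : a + k < suc n
  a+k< = <-≤-trans a+k<N N≤
  vertexRun : ∀ i → i ≤ k → vertexAt (a + i) ∈ A
  vertexRun i i≤k = lookupℕ⇒∈ A _
    (trans (cong (lookupℕ A) (toℕ-toFin n _ (unpos< (a + i) (≤-<-trans (+-monoʳ-≤ a i≤k) a+k<)))) (run i i≤k))
  adjacentRun : ∀ p → p < k → G (vertexAt (a + p)) (vertexAt (a + suc p))
  adjacentRun p p<k = subst (λ q → G (vertexAt (a + p)) (vertexAt q)) (sym (+-suc a p))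
    (adjacent (a + p) (subst (_< N) (+-suc a p) (≤-<-trans (+-monoʳ-≤ a p<k) a+k<N)))

sjc-path : ∀ n k₂ → suc (suc k₂) ≤ n →
           SjcIs (PathG (suc n)) (suc (suc k₂)) (suc n ∸ suc n / suc (suc (suc k₂)))
sjc-path n k₂ k≤n = (A⋆ , SJC-A⋆ forward (s≤s k≤n) , ∣A⋆∣) , upper
  where
  open Extremal (PathG (suc n)) (suc n) k₂ ≤-refl
  forward : ∀ {i j} → PathG (suc n) i j → i ∈ A⋆ → j ∈ A⋆ → toℕ i < toℕ j → suc (toℕ i) ≡ toℕ j
  forward (inj₁ e) _ _ _ = e
  forward (inj₂ e) _ _ i<j = ⊥-elim (<-asym i<j (subst (_ <_) e (n<1+n _)))
  upper : ∀ A → SJC (PathG (suc n)) k A → ∣ A ∣ ≤ suc n ∸ suc n / d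
  upper A = SJC⇒∣A∣≤ (PathG (suc n)) PathG-sym PathG-irrefl (identityRelabelling n) A (suc n) k₂ ≤-refl
              (∣A∣≡count A) (PathG-toFin n) (λ g _ _ → g)

module FullCycle (m k₂ : ℕ) (k<n : suc (suc (suc k₂)) ≤ suc (suc m)) where

  n k : ℕ
  n = suc (suc m)
  k = suc (suc k₂)

  k<1+n : k < suc n
  k<1+n = ≤-trans k<n (n≤1+n n)

  G : Graph (suc n)
  G = CycleG (suc n)

  open Witness (identityRelabelling n) 0 k₂ k<1+n using (B; inB; gapped-≤; gapped-k; ∈B)

  edgeAt : ℕ → Fin (suc n) × Fin (suc n)
  edgeAt t = toFin n t , toFin n (suc t)

  module _ {A m′} (H : SteinerSubgraph G A B m′) where
    open SteinerSubgraph H using (E; edgesOK)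
    open import Data.List.Membership.DecPropositional (≡-dec (Fin._≟_ {suc n}) (Fin._≟_ {suc n})) using () renaming (_∈?_ to _∈ₗ?_)

    allEdges⇒k≤ : (∀ t → t < n → edgeAt t ∈ₗ E) → k ≤ m′
    allEdges⇒k≤ all = ≤-trans (<⇒≤ k<n) (subst (n ≤_) (SteinerSubgraph.size H)
      (hits⇒≤length (λ e → toℕ (proj₁ e)) E 0 n (λ t t< → edgeAt t , all t t< , toℕ-toFin n t (<-trans t< (n<1+n n)))))

    -- Cutting the cycle at the missing edge {v, v + 1} leaves a path, along which B spans at least k.
    module MissingEdge (v : ℕ) (v<n : v < n) (missing : ¬ edgeAt v ∈ₗ E) where
      open LastAt {n} v (<⇒≤ v<n)

      v<1+n : v < suc n
      v<1+n = <-trans v<n (n<1+n n)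

      toℕ-n : ∀ x → posᶠ x ≡ n → toℕ x ≡ v
      toℕ-n x eq = trans (cong toℕ (posᶠ≡n⇒ x eq)) (toℕ-toFin n v v<1+n)

      toℕ-0 : ∀ x → posᶠ x ≡ 0 → toℕ x ≡ suc v
      toℕ-0 x eq = trans (cong toℕ (posᶠ-injective x _ (trans eq (sym (posᶠ-suc-v v<n))))) (toℕ-toFin n (suc v) (s≤s v<n))

      unitSteps : ∀ {i j} → (i , j) ∈ₗ E → UnitStep posᶠ i j
      unitSteps {i} {j} e∈E with edgesOK e∈E
      ... | i<j , c , _ , _ with CycleG⇒CycleAdj-pos c
      ...   | inj₁ e = inj₁ e
      ...   | inj₂ (inj₁ e) = inj₂ e
      ...   | inj₂ (inj₂ (inj₁ (i↦0 , j↦n))) =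
        ⊥-elim (<-asym i<j (subst₂ _<_ (sym (toℕ-n j (suc-injective j↦n))) (sym (toℕ-0 i i↦0)) (n<1+n v)))
      ...   | inj₂ (inj₂ (inj₂ (j↦0 , i↦n))) =
        ⊥-elim (missing (subst (_∈ₗ E) (cong₂ _,_ (posᶠ≡n⇒ i (suc-injective i↦n))
                                                  (toℕ-injective (trans (toℕ-0 j j↦0) (sym (toℕ-toFin n (suc v) (s≤s v<n)))))) e∈E))

      spanned : ∀ p q → p < suc n → q < suc n → inB p ≡ true → inB q ≡ true → ∀ {P Q} →
                posᶠ (toFin n p) ≡ P → posᶠ (toFin n q) ≡ Q → P ≤ Q → k ≤ Q ∸ P → k ≤ m′
      spanned p q p< q< p∈ q∈ refl refl P≤Q k≤ = ≤-trans k≤ (span≤size H posᶠ unitSteps (∈B p p< p∈) (∈B q q< q∈) P≤Q)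

      -- In each case, two vertices of B lie at least k apart on the cut path.
      byPosition : Tri (v < k₂) (v ≡ k₂) (k₂ < v) → k ≤ m′
      byPosition (tri< v<k₂ _ _) =
        spanned (suc v) v (s≤s v<n) v<1+n (gapped-≤ (suc v) v<k₂) (gapped-≤ v (<⇒≤ v<k₂)) (posᶠ-suc-v v<n) posᶠ-v z≤n (<⇒≤ k<n)
      byPosition (tri≈ _ v≡k₂ _) =
        spanned k v k<1+n v<1+n gapped-k (gapped-≤ v (≤-reflexive v≡k₂))
          (trans (cong (posᶠ ∘ toFin n) k≡) (posᶠ-> 1 (subst (_< suc n) k≡ k<1+n))) posᶠ-v
          (s≤s z≤n) (m+n≤o⇒m≤o∸n k (subst (_≤ n) (+-comm 1 k) k<n))
        where
        k≡ : k ≡ suc v + 1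
        k≡ = trans (cong (suc ∘ suc) (sym v≡k₂)) (cong suc (+-comm 1 v))
      byPosition (tri> _ _ k₂<v) with m≤n⇒m<n∨m≡n k₂<v
      ... | inj₂ sk₂≡v =
        spanned k k₂ k<1+n (<-trans k₂<v v<1+n) gapped-k (gapped-≤ k₂ ≤-refl)
          (trans (cong (posᶠ ∘ toFin n) k≡) (posᶠ-> 0 (subst (_< suc n) k≡ k<1+n))) (posᶠ-≤ k₂ (<⇒≤ k₂<v))
          z≤n k≤
        where
        k≡ : k ≡ suc v + 0
        k≡ = trans (cong suc sk₂≡v) (sym (+-identityʳ (suc v)))
        k≤ : k ≤ k₂ + r
        k≤ = subst (_≤ k₂ + r) (+-comm k₂ 2) (+-monoʳ-≤ k₂ (m+n≤o⇒m≤o∸n 2 (subst (λ w → 2 + w ≤ n) sk₂≡v k<n)))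
      ... | inj₁ k≤v =
        spanned 0 k (s≤s z≤n) k<1+n (gapped-≤ 0 z≤n) gapped-k (posᶠ-≤ 0 z≤n) (posᶠ-≤ k k≤v)
          (m≤n+m r k) (≤-reflexive (sym (m+n∸n≡m k r)))

    fullCycle-k≤ : k ≤ m′
    fullCycle-k≤ with anyUpTo? (λ t → ¬? (edgeAt t ∈ₗ? E)) n
    ... | yes (v , v<n , missing) = MissingEdge.byPosition v v<n missing (<-cmp v k₂)
    ... | no ¬missing = allEdges⇒k≤ (λ t t< → decidable-stable (edgeAt t ∈ₗ? E) (λ ∉ → ¬missing (t , t< , ∉)))

  ¬SJC : ∀ A → (∀ x → x ∈ A) → ¬ SJC G k A
  ¬SJC A full (_ , critical) =
    critical B (λ _ → full _) ∣B∣≡k (steinerB , λ m′ m′<k H → <⇒≱ m′<k (fullCycle-k≤ H))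
    where
    open Run⇒¬SJC G CycleG-sym CycleG-irrefl (identityRelabelling n) A 0 k₂ k<1+n
           (λ _ _ → full _) (λ p p<k → inj₁ (PathG-toFin n p (≤-trans (s≤s p<k) k<1+n))) using (∣B∣≡k; steinerB)

sjc-cycle : ∀ m k₂ → suc (suc (suc k₂)) ≤ suc (suc m) →
            SjcIs (CycleG (3 + m)) (suc (suc k₂)) (suc (suc m) ∸ suc (suc m) / suc (suc (suc k₂)))
sjc-cycle m k₂ k<n = (A⋆ , SJC-A⋆ forward k<n , ∣A⋆∣) , upper
  where
  n : ℕ
  n = suc (suc m)
  G : Graph (suc n)
  G = CycleG (suc n)
  open Extremal G n k₂ (n≤1+n n)
  -- The wrap-around edge is never inside A⋆: its endpoint n is not below N = n.
  forward : ∀ {i j} → G i j → i ∈ A⋆ → j ∈ A⋆ → toℕ i < toℕ j → suc (toℕ i) ≡ toℕ j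
  forward (inj₁ (inj₁ e)) _ _ _ = e
  forward (inj₁ (inj₂ e)) _ _ i<j = ⊥-elim (<-asym i<j (subst (_ <_) e (n<1+n _)))
  forward {i} {j} (inj₂ (inj₁ (_ , e))) _ j∈ _ =
    ⊥-elim (<-irrefl (suc-injective e) (does-true (toℕ j <? n) (proj₁ (∧-true (∈fromPred⇒ (notBlockEndBelow n k) j j∈)))))
  forward {i} {j} (inj₂ (inj₂ (e , _))) _ _ i<j = ⊥-elim (n≮0 (subst (toℕ i <_) e i<j))
  upper : ∀ A → SJC G k A → ∣ A ∣ ≤ n ∸ n / d
  upper A sjc with all? (_∈? A)
  ... | yes full = ⊥-elim (FullCycle.¬SJC m k₂ k<n A full sjc)
  ... | no ¬full with ¬∀⟶∃¬ (suc n) (_∈ A) (_∈? A) ¬full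
  ... | v , v∉A = SJC⇒∣A∣≤ G CycleG-sym CycleG-irrefl R A n k₂ (n≤1+n n) ∣A∣≡ (λ p sp< → adjacent p (<-trans sp< (n<1+n n))) unitSteps sjc
    where
    open LastAt (toℕ v) (≤-pred (toℕ<n v))
    ∣A∣≡ : ∣ A ∣ ≡ count (λ p → lookupℕ A (unpos p)) n
    ∣A∣≡ = begin
      ∣ A ∣                                      ≡⟨ ∣A∣≡count A ⟩
      count (lookupℕ A) (suc n)                  ≡⟨ count-unpos (lookupℕ A) ⟨
      count (λ p → lookupℕ A (unpos p)) (suc n)  ≡⟨ count-suc (λ p → lookupℕ A (unpos p)) n ⟩
      count (λ p → lookupℕ A (unpos p)) n + bit (lookupℕ A (unpos n))
        ≡⟨ cong (λ b → count (λ p → lookupℕ A (unpos p)) n + bit b) (trans (cong (lookupℕ A) unpos-n) (∉⇒lookupℕ A v v∉A)) ⟩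
      count (λ p → lookupℕ A (unpos p)) n + 0    ≡⟨ +-identityʳ _ ⟩
      count (λ p → lookupℕ A (unpos p)) n        ∎
      where
      open ≡-Reasoning
      unpos-n : unpos n ≡ toℕ v
      unpos-n = trans (sym (toℕ-toFin n (unpos n) (unpos< n ≤-refl)))
                      (cong toℕ (trans (cong vertexAt (sym posᶠ-v)) (trans (vertexAt-posᶠ _) (toFin-toℕ n v))))
    ≢n : ∀ {x} → x ∈ A → posᶠ x ≢ n
    ≢n {x} x∈A eq = v∉A (subst (_∈ A) (trans (posᶠ≡n⇒ x eq) (toFin-toℕ n v)) x∈A)
    unitSteps : ∀ {i j} → G i j → i ∈ A → j ∈ A → UnitStep posᶠ i j
    unitSteps c i∈A j∈A = CycleAdj⇒UnitStep (CycleG⇒CycleAdj-pos c) (≢n i∈A) (≢n j∈A)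

sjc-cycle-top : ∀ m → SjcIs (CycleG (3 + m)) (suc (suc m)) (3 + m)
sjc-cycle-top m = (⊤ , (subst (n ≤_) (sym (∣⊤∣≡n (suc n))) (n≤1+n n) , noDistance) , ∣⊤∣≡n (suc n)) ,
                  λ A _ → ∣p∣≤n A
  where
  n : ℕ
  n = suc (suc m)
  G : Graph (suc n)
  G = CycleG (suc n)
  noDistance : ∀ B → B ⊆ ⊤ → ∣ B ∣ ≡ n → ¬ SteinerDistIs G ⊤ B n
  noDistance B _ ∣B∣≡n (_ , minimal) with all? (_∈? B)
  ... | yes full = 1+n≰n (subst₂ _≤_ (∣⊤∣≡n (suc n)) ∣B∣≡n (p⊆q⇒∣p∣≤∣q∣ {p = ⊤} (λ _ → full _)))
  ... | no ¬full with ¬∀⟶∃¬ (suc n) (_∈ B) (_∈? B) ¬full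
  ... | w , w∉B = minimal (suc m) ≤-refl (pathSubgraph ⊤ B (λ _ → ∈⊤) B⊆S)
    where
    open LastAt (toℕ w) (≤-pred (toℕ<n w))
    open PositionPath G CycleG-sym CycleG-irrefl R 0 (suc m) (n≤1+n _)
           (λ p p< → adjacent p (≤-trans (s≤s p<) (n≤1+n _))) using (S; pathSubgraph; ⇒∈S)
    B⊆S : B ⊆ S
    B⊆S {x} x∈B = ⇒∈S x z≤n (≤-pred (≤∧≢⇒< (≤-pred (posᶠ< x)) ≢n))
      where
      ≢n : posᶠ x ≢ n
      ≢n eq = w∉B (subst (_∈ B) (trans (posᶠ≡n⇒ x eq) (toFin-toℕ n w)) x∈B)

proposition4p3 : (n : ℕ) → 3 ≤ n →
    ((k : ℕ) → 2 ≤ k → k ≤ n ∸ 1 → SjcIs (PathG n) k (n ∸ (n / suc k)))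
    × ((l : ℕ) → 2 ≤ l → l ≤ n ∸ 2 → SjcIs (CycleG n) l ((n ∸ 1) ∸ ((n ∸ 1) / suc l)))
    × SjcIs (CycleG n) (n ∸ 1) n
proposition4p3 (suc (suc (suc m))) (s≤s (s≤s (s≤s _))) =
    (λ { (suc (suc k₂)) (s≤s (s≤s _)) k≤ → sjc-path (suc (suc m)) k₂ k≤ })
  , (λ { (suc (suc l₂)) (s≤s (s≤s _)) l≤ → sjc-cycle m l₂ (s≤s l≤) })
  , sjc-cycle-top m
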